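{- Let $1<d_1<d_2<d_3$ be integers with $\gcd(d_1,d_2)=1$ such that $\{d_1,d_2,d_3\}$ is a minimal generating set of the semigroup $S(d_1,d_2,d_3)$. Let $a_{33}=\min\{v\ge2: vd_3=v_1d_1+v_2d_2,\ v_1,v_2\in\mathbb Z_{\ge0}\}$. For $1\le k<a_{33}$ write $kd_3=d_1d_2-p_{kd_3}d_1-q_{kd_3}d_2$ with integers $p_{kd_3},q_{kd_3}\ge1$, and set $\Omega^k=\{u_1d_1+u_2d_2+kd_3:\ 0\le u_1\le p_{kd_3}-1,\ 0\le u_2\le q_{kd_3}-1\}$. Then $$\Delta(d_1,d_2,d_3)=\Delta(d_1,d_2)\setminus\bigcup_{k=1}^{a_{33}-1}\Omega^k.$$
   Context: $S(d_1,d_2,d_3)$ is the set of nonnegative integer combinations of $d_1,d_2,d_3$; minimal means no $d_i$ is a nonnegative integer combination of the other two. For a tuple of positive integers, $\Delta(\cdot)$ denotes the set of positive integers not representable as nonnegative integer combinations of its entries. For $\gcd(d_1,d_2)=1$, every $t\in\Delta(d_1,d_2)$ has a unique representation $t=d_1d_2-pd_1-qd_2$ with $1\le p\le\lfloor d_2-d_2/d_1\rfloor$, $1\le q\le d_1-1$; and $kd_3\in\Delta(d_1,d_2)$ for $1\le k<a_{33}$. -}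

module Defs where

open import Data.Nat using (ℕ; _+_; _*_; _≤_; _<_)
open import Data.Product using (Σ; ∃; ∃-syntax; _×_; _,_)
open import Relation.Nullary using (¬_)
open import Relation.Unary using (Pred; _∖_; ⋃)
open import Relation.Binary.PropositionalEquality using (_≡_)
open import Level using (0ℓ)

S₂ : ℕ → ℕ → Pred ℕ 0ℓ
S₂ a b t = ∃[ x ] ∃[ y ] x * a + y * b ≡ t

S₃ : ℕ → ℕ → ℕ → Pred ℕ 0ℓ
S₃ a b c t = ∃[ x ] ∃[ y ] ∃[ z ] x * a + y * b + z * c ≡ t

Δ₂ : ℕ → ℕ → Pred ℕ 0ℓ
Δ₂ a b t = 1 ≤ t × ¬ S₂ a b t

Δ₃ : ℕ → ℕ → ℕ → Pred ℕ 0ℓ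
Δ₃ a b c t = 1 ≤ t × ¬ S₃ a b c t

MinimalGens : ℕ → ℕ → ℕ → Set
MinimalGens d₁ d₂ d₃ = ¬ S₂ d₂ d₃ d₁ × ¬ S₂ d₁ d₃ d₂ × ¬ S₂ d₁ d₂ d₃

IsA33 : ℕ → ℕ → ℕ → ℕ → Set
IsA33 d₁ d₂ d₃ a =
  2 ≤ a × S₂ d₁ d₂ (a * d₃) × (∀ v → 2 ≤ v → S₂ d₁ d₂ (v * d₃) → a ≤ v)

-- Ω^k = {u1 d1 + u2 d2 + k d3 : 0 ≤ u1 ≤ p-1, 0 ≤ u2 ≤ q-1}, where
-- k d3 = d1 d2 - p d1 - q d2 with p, q ≥ 1 (written additively to avoid
-- truncated subtraction; such p, q are unique).
Ω : ℕ → ℕ → ℕ → ℕ → Pred ℕ 0ℓ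
Ω d₁ d₂ d₃ k t =
  ∃[ p ] ∃[ q ] (1 ≤ p × 1 ≤ q × k * d₃ + p * d₁ + q * d₂ ≡ d₁ * d₂ ×
    ∃[ u₁ ] ∃[ u₂ ] (u₁ < p × u₂ < q × u₁ * d₁ + u₂ * d₂ + k * d₃ ≡ t))

ΩUnion : ℕ → ℕ → ℕ → ℕ → Pred ℕ 0ℓ
ΩUnion d₁ d₂ d₃ a t = ∃[ k ] (1 ≤ k × k < a × Ω d₁ d₂ d₃ k t)

{-# OPTIONS --safe #-}

-- Reducing the d₃-coefficient modulo a₃₃ (possible since a₃₃ d₃ ∈ S(d₁,d₂)) writes every
-- element of S(d₁,d₂,d₃) as x d₁ + y d₂ + k d₃ with k < a₃₃.  For 1 ≤ k < a₃₃ the number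
-- k d₃ is a gap of S(d₁,d₂), so k d₃ + p d₁ + q d₂ = d₁ d₂ with p, q ≥ 1; trading
-- p d₁ + q d₂ for d₁ d₂ puts the element in S(d₁,d₂) as soon as x ≥ p or y ≥ q, and
-- otherwise it lies in Ωᵏ.  The coordinates of a gap n come from a Bézout inverse of d₂
-- modulo d₁: it yields r < d₁ with r d₂ ≡ n (mod d₁), and since n is a gap,
-- n + p d₁ = r d₂ with p ≥ 1, so q = d₁ - r.

module Submission where

open import Defs
open import Data.Nat using (ℕ; zero; suc; _+_; _*_; _≤_; _<_; z≤n; s≤s; _≤?_; _%_; _/_; NonZero; >-nonZero)
open import Data.Nat.Properties
open import Data.Nat.DivMod using (m≡m%n+[m/n]*n; m%n<n)
open import Data.Nat.GCD using (gcd; module Bézout)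
open import Data.Nat.Coprimality using (Coprime; coprime-Bézout; gcd≡1⇒coprime)
open import Data.Nat.Tactic.RingSolver using (solve)
open import Data.List using ([]; _∷_)
open import Data.Product using (_×_; _,_; ∃-syntax)
open import Data.Sum using (_⊎_; inj₁; inj₂; [_,_])
open import Function using (_∘_)
open import Relation.Nullary using (¬_; yes; no; contradiction)
open import Relation.Unary using (_≐_; _∖_; _⊆_; _∪_)
open import Relation.Binary.PropositionalEquality using (_≡_; refl; sym; trans; cong; subst; module ≡-Reasoning)

open ≡-Reasoning

S₂-swap : ∀ {a b t} → S₂ a b t → S₂ b a t
S₂-swap {a} {b} (x , y , eq) = y , x , trans (+-comm (y * b) (x * a)) eq

S₂⊆S₃ : ∀ {a b c} → S₂ a b ⊆ S₃ a b c
S₂⊆S₃ (x , y , eq) = x , y , 0 , trans (+-identityʳ _) eq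

ΩUnion⊆S₃ : ∀ {a b c m} → ΩUnion a b c m ⊆ S₃ a b c
ΩUnion⊆S₃ (k , _ , _ , _ , _ , _ , _ , _ , u₁ , u₂ , _ , _ , eq) = u₁ , u₂ , k , eq

GapCoordinates : ℕ → ℕ → ℕ → Set
GapCoordinates a b n = ∃[ p ] ∃[ q ] (1 ≤ p × 1 ≤ q × n + p * a + q * b ≡ a * b)

gap-equation-swap : ∀ a b n p q → n + p * a + q * b ≡ a * b → n + q * b + p * a ≡ b * a
gap-equation-swap a b n p q eq = begin
  n + q * b + p * a ≡⟨ solve (n ∷ p ∷ q ∷ a ∷ b ∷ []) ⟩
  n + p * a + q * b ≡⟨ eq ⟩
  a * b             ≡⟨ *-comm a b ⟩
  b * a             ∎

congruent-≤⇒differ-by-multiple : ∀ {u v i j} a → i ≤ j → u + i * a ≡ v + j * a →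
  ∃[ m ] v + m * a ≡ u
congruent-≤⇒differ-by-multiple {u} {v} {i} a i≤j eq with m≤n⇒∃[o]m+o≡n i≤j
... | m , refl = m , sym (+-cancelʳ-≡ (i * a) u (v + m * a) (begin
  u + i * a         ≡⟨ eq ⟩
  v + (i + m) * a   ≡⟨ solve (v ∷ i ∷ m ∷ a ∷ []) ⟩
  v + m * a + i * a ∎))

congruent⇒differ-by-multiple : ∀ {u v} i j a → u + i * a ≡ v + j * a →
  (∃[ m ] u + m * a ≡ v) ⊎ (∃[ m ] v + m * a ≡ u)
congruent⇒differ-by-multiple i j a eq with ≤-total i j
... | inj₁ i≤j = inj₂ (congruent-≤⇒differ-by-multiple a i≤j eq)
... | inj₂ j≤i = inj₁ (congruent-≤⇒differ-by-multiple a j≤i (sym eq))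

gap-from-residue : ∀ {a b n r} i j → r < a → r * b + i * a ≡ n + j * a → ¬ S₂ a b n →
  GapCoordinates a b n
gap-from-residue {a} {b} {n} {r} i j r<a eq n∉S with congruent⇒differ-by-multiple i j a eq
... | inj₁ (m , rb+ma≡n) = contradiction (m , r , trans (+-comm (m * a) (r * b)) rb+ma≡n) n∉S
... | inj₂ (zero , n+0≡rb) = contradiction (0 , r , sym (trans (sym (+-identityʳ n)) n+0≡rb)) n∉S
... | inj₂ (suc m , n+pa≡rb) with m≤n⇒∃[o]m+o≡n r<a
...   | c , refl = suc m , suc c , s≤s z≤n , s≤s z≤n , (begin
  n + suc m * a + suc c * b ≡⟨ cong (_+ suc c * b) n+pa≡rb ⟩
  r * b + suc c * b         ≡⟨ solve (r ∷ c ∷ b ∷ []) ⟩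
  (suc r + c) * b           ∎)

residue-congruence : ∀ {a b n r k y e} → n * y ≡ r + k * a → y * b ≡ 1 + e * a →
  r * b + k * b * a ≡ n + n * e * a
residue-congruence {a} {b} {n} {r} {k} {y} {e} ny≡r+ka yb≡1+ea = begin
  r * b + k * b * a ≡⟨ solve (r ∷ k ∷ a ∷ b ∷ []) ⟩
  (r + k * a) * b   ≡⟨ cong (_* b) ny≡r+ka ⟨
  n * y * b         ≡⟨ *-assoc n y b ⟩
  n * (y * b)       ≡⟨ cong (n *_) yb≡1+ea ⟩
  n * (1 + e * a)   ≡⟨ solve (n ∷ e ∷ a ∷ []) ⟩
  n + n * e * a     ∎

gap-from-inverse : ∀ {a b n} y e .{{_ : NonZero a}} → y * b ≡ 1 + e * a → ¬ S₂ a b n →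
  GapCoordinates a b n
gap-from-inverse {a} {b} {n} y e inverse =
  gap-from-residue (n * y / a * b) (n * e) (m%n<n (n * y) a)
    (residue-congruence {n = n} {r = n * y % a} {k = n * y / a} (m≡m%n+[m/n]*n (n * y) a) inverse)

gap-representation : ∀ {a b n} → 0 < a → 0 < b → Coprime a b → ¬ S₂ a b n →
  GapCoordinates a b n
gap-representation {a} {b} {n} a>0 b>0 coprime n∉S with coprime-Bézout coprime
... | Bézout.-+ x y 1+xa≡yb = gap-from-inverse y x {{>-nonZero a>0}} (sym 1+xa≡yb) n∉S
... | Bézout.+- x y 1+yb≡xa with gap-from-inverse x y {{>-nonZero b>0}} (sym 1+yb≡xa) (n∉S ∘ S₂-swap)
...   | q , p , 1≤q , 1≤p , eq = p , q , 1≤p , 1≤q , gap-equation-swap b a n q p eq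

S₂-absorbˡ : ∀ {a b n p q} x y → 0 < b → n + p * a + q * b ≡ a * b → p ≤ x →
  S₂ a b (x * a + y * b + n)
S₂-absorbˡ {a} {b} {n} {p} {q} x y b>0 gap p≤x
  with m≤n⇒∃[o]m+o≡n p≤x | m≤n⇒∃[o]m+o≡n q≤a
  where
  q≤a : q ≤ a
  q≤a = *-cancelʳ-≤ q a b {{>-nonZero b>0}}
    (subst (q * b ≤_) gap (m≤n+m (q * b) (n + p * a)))
... | x′ , refl | c , q+c≡a = x′ , y + c , (begin
  x′ * a + (y + c) * b         ≡⟨ solve (x′ ∷ y ∷ c ∷ a ∷ b ∷ []) ⟩
  x′ * a + y * b + c * b       ≡⟨ cong (x′ * a + y * b +_) n+pa≡cb ⟨
  x′ * a + y * b + (n + p * a) ≡⟨ solve (x′ ∷ y ∷ n ∷ p ∷ a ∷ b ∷ []) ⟩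
  (p + x′) * a + y * b + n     ∎)
  where
  n+pa≡cb : n + p * a ≡ c * b
  n+pa≡cb = +-cancelʳ-≡ (q * b) _ _ (begin
    n + p * a + q * b ≡⟨ gap ⟩
    a * b             ≡⟨ cong (_* b) q+c≡a ⟨
    (q + c) * b       ≡⟨ solve (q ∷ c ∷ b ∷ []) ⟩
    c * b + q * b     ∎)

S₂-absorbʳ : ∀ {a b n p q} x y → 0 < a → n + p * a + q * b ≡ a * b → q ≤ y →
  S₂ a b (x * a + y * b + n)
S₂-absorbʳ {a} {b} {n} {p} {q} x y a>0 gap q≤y =
  subst (S₂ a b) (cong (_+ n) (+-comm (y * b) (x * a)))
    (S₂-swap (S₂-absorbˡ {p = q} {q = p} y x a>0 (gap-equation-swap a b n p q gap) q≤y))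

S₂-or-below : ∀ {a b n p q} x y → 0 < a → 0 < b → n + p * a + q * b ≡ a * b →
  S₂ a b (x * a + y * b + n) ⊎ (x < p × y < q)
S₂-or-below {p = p} {q} x y a>0 b>0 gap with p ≤? x | q ≤? y
... | yes p≤x | _       = inj₁ (S₂-absorbˡ {p = p} {q = q} x y b>0 gap p≤x)
... | no _    | yes q≤y = inj₁ (S₂-absorbʳ {p = p} {q = q} x y a>0 gap q≤y)
... | no p≰x  | no q≰y  = inj₂ (≰⇒> p≰x , ≰⇒> q≰y)

S₃-reduce : ∀ {a b c t} m .{{_ : NonZero m}} → S₂ a b (m * c) → S₃ a b c t →
  ∃[ x ] ∃[ y ] ∃[ z ] (z < m × x * a + y * b + z * c ≡ t)
S₃-reduce {a} {b} {c} {t} m (α , β , mc) (x , y , z , eq)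
  -- generalising z % m and z / m lets the ring solver treat them as variables
  with z % m | z / m | m≡m%n+[m/n]*n z m | m%n<n z m
... | r | j | z≡r+jm | r<m = x + j * α , y + j * β , r , r<m , (begin
  (x + j * α) * a + (y + j * β) * b + r * c     ≡⟨ solve (x ∷ y ∷ r ∷ j ∷ α ∷ β ∷ a ∷ b ∷ c ∷ []) ⟩
  x * a + y * b + (r * c + j * (α * a + β * b)) ≡⟨ cong (λ w → x * a + y * b + (r * c + j * w)) mc ⟩
  x * a + y * b + (r * c + j * (m * c))         ≡⟨ solve (x ∷ y ∷ r ∷ j ∷ m ∷ a ∷ b ∷ c ∷ []) ⟩
  x * a + y * b + (r + j * m) * c               ≡⟨ cong (λ w → x * a + y * b + w * c) z≡r+jm ⟨
  x * a + y * b + z * c                         ≡⟨ eq ⟩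
  t                                             ∎)

IsA33⇒gap : ∀ {a b c m k} → ¬ S₂ a b c → IsA33 a b c m → 1 ≤ k → k < m → ¬ S₂ a b (k * c)
IsA33⇒gap {c = c} {k = 1} c∉S _ _ _ = c∉S ∘ subst (S₂ _ _) (*-identityˡ c)
IsA33⇒gap {k = suc (suc k)} _ (_ , _ , minimal) _ k<m kc∈S =
  <⇒≱ k<m (minimal _ (s≤s (s≤s z≤n)) kc∈S)

S₃⊆S₂∪ΩUnion : ∀ {a b c m} → 0 < a → 0 < b → Coprime a b → ¬ S₂ a b c → IsA33 a b c m →
  S₃ a b c ⊆ S₂ a b ∪ ΩUnion a b c m
S₃⊆S₂∪ΩUnion {a} {b} {c} {m} a>0 b>0 coprime c∉S isA33@(2≤m , mc∈S , _) t∈S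
  with S₃-reduce m {{>-nonZero (≤-trans (s≤s z≤n) 2≤m)}} mc∈S t∈S
... | x , y , zero , _ , eq = inj₁ (x , y , trans (sym (+-identityʳ _)) eq)
... | x , y , k@(suc _) , k<m , eq
  with gap-representation a>0 b>0 coprime (IsA33⇒gap c∉S isA33 (s≤s z≤n) k<m)
... | p , q , 1≤p , 1≤q , gap with S₂-or-below {p = p} {q = q} x y a>0 b>0 gap
...   | inj₁ s = inj₁ (subst (S₂ a b) eq s)
...   | inj₂ (x<p , y<q) =
  inj₂ (k , s≤s z≤n , k<m , p , q , 1≤p , 1≤q , gap , x , y , x<p , y<q , eq)

theorem2 : (d₁ d₂ d₃ : ℕ) → 1 < d₁ → d₁ < d₂ → d₂ < d₃ → gcd d₁ d₂ ≡ 1 →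
    MinimalGens d₁ d₂ d₃ → (a₃₃ : ℕ) → IsA33 d₁ d₂ d₃ a₃₃ →
    Δ₃ d₁ d₂ d₃ ≐ (Δ₂ d₁ d₂ ∖ ΩUnion d₁ d₂ d₃ a₃₃)
theorem2 d₁ d₂ d₃ 1<d₁ d₁<d₂ _ gcd≡1 (_ , _ , d₃∉S) a₃₃ isA33 = Δ₃⊆ , ⊆Δ₃
  where
  d₁>0 : 0 < d₁
  d₁>0 = <-trans (s≤s z≤n) 1<d₁
  d₂>0 : 0 < d₂
  d₂>0 = <-trans d₁>0 d₁<d₂
  Δ₃⊆ : Δ₃ d₁ d₂ d₃ ⊆ Δ₂ d₁ d₂ ∖ ΩUnion d₁ d₂ d₃ a₃₃
  Δ₃⊆ (t≥1 , t∉S₃) = (t≥1 , t∉S₃ ∘ S₂⊆S₃) , t∉S₃ ∘ ΩUnion⊆S₃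
  ⊆Δ₃ : Δ₂ d₁ d₂ ∖ ΩUnion d₁ d₂ d₃ a₃₃ ⊆ Δ₃ d₁ d₂ d₃
  ⊆Δ₃ ((t≥1 , t∉S₂) , t∉Ω) =
    t≥1 , [ t∉S₂ , t∉Ω ] ∘ S₃⊆S₂∪ΩUnion d₁>0 d₂>0 (gcd≡1⇒coprime gcd≡1) d₃∉S isA33
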